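{- Let $G$ be a graph of bounded degree that is quasi-isometric to a tree of bounded degree. Then $G$ is minor excluded.
   Context: For graphs $G,T$ with graph distances $d_G,d_T$, $G$ is quasi-isometric to $T$ if there is a map $\varphi\colon V(G)\to V(T)$ and constants $\gamma\ge 1$, $c\ge 0$ with $\frac{1}{\gamma}d_T(\varphi(x),\varphi(y))-c\le d_G(x,y)\le \gamma d_T(\varphi(x),\varphi(y))+c$ for all $x,y\in V(G)$. A graph $H$ is a minor of $G$ if there are pairwise disjoint nonempty sets $G_x\subseteq V(G)$, $x\in V(H)$, each inducing a connected subgraph of $G$, such that for every edge $xy\in E(H)$ there is an edge of $G$ between $G_x$ and $G_y$. A graph is minor excluded if there exists some finite graph that is not a minor of it. -}

module Defs where

open import Data.Nat using (ℕ; zero; suc; _+_; _*_; _≤_)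
open import Data.Fin using (Fin)
open import Data.List using (List; []; _∷_; _++_; length)
open import Data.List.Relation.Unary.All using (All)
open import Data.List.Relation.Unary.Unique.Propositional using (Unique)
open import Data.List.Relation.Unary.Linked using (Linked)
open import Data.Product using (Σ; ∃; _×_; _,_)
open import Data.Empty using (⊥)
open import Relation.Nullary using (¬_)
open import Relation.Binary.PropositionalEquality using (_≡_)

record Graph (V : Set) : Set₁ where
  field
    E      : V → V → Set
    sym    : ∀ {x y} → E x y → E y x
    irrefl : ∀ {x} → ¬ E x x
open Graph public

data Walk {V : Set} (G : Graph V) : V → V → ℕ → Set where
  nil  : ∀ {x} → Walk G x x 0
  cons : ∀ {x y z n} → E G x y → Walk G y z n → Walk G x z (suc n)

-- d_G(x,y) ≤ k  (the graph distance, valued in ℕ ∪ {∞}, is at most k)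
DistLe : {V : Set} → Graph V → V → V → ℕ → Set
DistLe G x y k = ∃ λ n → n ≤ k × Walk G x y n

data WalkIn {V : Set} (G : Graph V) (P : V → Set) : V → V → Set where
  nil  : ∀ {x} → P x → WalkIn G P x x
  cons : ∀ {x y z} → P x → E G x y → WalkIn G P y z → WalkIn G P x z

Connected : {V : Set} → Graph V → Set
Connected G = ∀ x y → ∃ λ n → Walk G x y n

Cycle : {V : Set} → Graph V → Set
Cycle {V} G = Σ V λ x → Σ (List V) λ p →
  2 ≤ length p × Unique (x ∷ p) × Linked (E G) (x ∷ p ++ x ∷ [])

IsTree : {V : Set} → Graph V → Set
IsTree G = Connected G × ¬ Cycle G

BoundedDegree : {V : Set} → Graph V → Set
BoundedDegree {V} G = ∃ λ (Δ : ℕ) → ∀ (v : V) (l : List V) →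
  Unique l → All (E G v) l → length l ≤ Δ

-- Quasi-isometry G → T with constants γ ≥ 1, c ≥ 0 (taken natural):
--   (1/γ) d_T(φx,φy) − c ≤ d_G(x,y)   i.e.  d_T(φx,φy) ≤ γ (d_G(x,y) + c)
--   d_G(x,y) ≤ γ d_T(φx,φy) + c
QuasiIsometric : {V W : Set} → Graph V → Graph W → Set
QuasiIsometric {V} {W} G T = Σ (V → W) λ φ → Σ ℕ λ γ → Σ ℕ λ c →
  1 ≤ γ ×
  (∀ x y m → DistLe G x y m → DistLe T (φ x) (φ y) (γ * (m + c))) ×
  (∀ x y n → DistLe T (φ x) (φ y) n → DistLe G x y (γ * n + c))

IsMinor : {U V : Set} → Graph U → Graph V → Set₁
IsMinor {U} {V} H G = Σ (U → V → Set) λ B →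
  (∀ x → ∃ λ v → B x v) ×
  (∀ x y v → B x v → B y v → x ≡ y) ×
  (∀ x u v → B x u → B x v → WalkIn G (B x) u v) ×
  (∀ x y → E H x y → ∃ λ u → ∃ λ v → B x u × B y v × E G u v)

MinorExcluded : {V : Set} → Graph V → Set₁
MinorExcluded G = Σ ℕ λ n → Σ (Graph (Fin n)) λ H → ¬ IsMinor H G

-- Root the tree at some vertex and, for every branch set Bᵢ of a putative Kₙ minor, let Dᵢ be the
-- tree distance from the root to φ(Bᵢ); take a branch set B* realising the largest Dᵢ, and on a
-- geodesic from the root to a nearest point of φ(B*) let p be the vertex M steps before its end,
-- where M exceeds the tree distance K between images of adjacent vertices.
-- Every other branch set Bⱼ is joined to B* by an edge of G, so following a geodesic to φ(Bⱼ) and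
-- then the coarse image of a path through Bⱼ ∪ B* gives a walk from the root to φ(B*); in a tree
-- it passes through p.  As p is not within K of φ(B*) (that would bring B* closer to the root),
-- p lies on the geodesic within M of its end, or within K of φ(Bⱼ).  Hence every branch set has
-- a vertex whose image is within M of p; by the quasi-isometry these n vertices are pairwise
-- within a fixed G-distance Q, and bounded degree bounds the size of a Q-ball, so n cannot be
-- large.  All existence claims are only needed under double negation, because the goal is ⊥.
module Submission where

open import Defs
open import Level using (0ℓ)
open import Data.Nat using (ℕ; zero; suc; _+_; _*_; _≤_; _<_; z≤n; s≤s; _≤?_)
open import Data.Nat.Properties
open import Data.Nat.Induction using (<-rec)
open import Data.Fin using (Fin; zero; suc)
import Data.Fin.Properties as Fin
open import Data.List using (List; []; _∷_; _++_; length; lookup; allFin)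
open import Data.List.Properties using (length-++; ++-assoc)
open import Data.List.Extrema.Nat using (argmax; f[xs]≤f[argmax])
open import Data.List.Relation.Unary.All as All using (All; []; _∷_)
open import Data.List.Relation.Unary.All.Properties using (¬Any⇒All¬; ++⁻ˡ)
open import Data.List.Relation.Unary.Any using (here; there; index)
open import Data.List.Relation.Unary.Any.Properties using (lookup-index)
open import Data.List.Relation.Unary.Unique.Propositional using (Unique)
open import Data.List.Relation.Unary.AllPairs using ([]; _∷_)
open import Data.List.Relation.Unary.Linked using (Linked; []; [-]; _∷_)
open import Data.List.Membership.Propositional using (_∈_; _∉_)
open import Data.List.Membership.Propositional.Properties using (∈-∃++; ∈-++⁺ˡ; ∈-++⁺ʳ; ∈-allFin)
open import Data.Product using (∃; ∃₂; _×_; _,_; proj₁; proj₂)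
open import Data.Sum using (_⊎_; inj₁; inj₂; [_,_]′)
open import Data.Empty using (⊥; ⊥-elim)
open import Effect.Monad using (RawMonad)
open import Function using (_∘_)
open import Function.Definitions using (Injective)
open import Relation.Nullary using (¬_; yes; no)
open import Relation.Nullary.Negation using (¬¬-Monad; ¬¬-map)
open import Relation.Nullary.Decidable using (¬¬-excluded-middle)
open import Relation.Unary using (_∪_; _⊆_)
open import Relation.Binary.PropositionalEquality as ≡ using (_≡_; _≢_; refl; trans; cong; subst)

open RawMonad (¬¬-Monad {0ℓ}) using (_>>=_; pure; rawApplicative)

module Walks {X : Set} {Γ : Graph X} where

  private
    variable
      x y z p : X
      m n : ℕ

  vertices : Walk Γ x y n → List X
  laterVertices : Walk Γ x y n → List X

  vertices {x = x} w = x ∷ laterVertices w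

  laterVertices nil = []
  laterVertices (cons _ w) = vertices w

  _++ʷ_ : Walk Γ x y m → Walk Γ y z n → Walk Γ x z (m + n)
  nil ++ʷ w′ = w′
  cons e w ++ʷ w′ = cons e (w ++ʷ w′)

  end∈vertices : (w : Walk Γ x y n) → y ∈ vertices w
  end∈vertices nil = here refl
  end∈vertices (cons _ w) = there (end∈vertices w)

  vertices-++ʷ : (w : Walk Γ x y m) (w′ : Walk Γ y z n) →
    ∃ λ A → vertices (w ++ʷ w′) ≡ A ++ vertices w′
  vertices-++ʷ nil w′ = [] , refl
  vertices-++ʷ {x = x} (cons e w) w′ with vertices-++ʷ w w′
  ... | A , eq = x ∷ A , cong (x ∷_) eq

  ∈-++ʷ⁻ : (w : Walk Γ x y m) (w′ : Walk Γ y z n) →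
    p ∈ vertices (w ++ʷ w′) → p ∈ vertices w ⊎ p ∈ vertices w′
  ∈-++ʷ⁻ nil w′ p∈ = inj₂ p∈
  ∈-++ʷ⁻ (cons e w) w′ (here p≡x) = inj₁ (here p≡x)
  ∈-++ʷ⁻ (cons e w) w′ (there p∈) with ∈-++ʷ⁻ w w′ p∈
  ... | inj₁ p∈w = inj₁ (there p∈w)
  ... | inj₂ p∈w′ = inj₂ p∈w′

  splitAt-∈ : (w : Walk Γ x y n) → p ∈ vertices w →
    ∃₂ λ n₁ n₂ → Walk Γ x p n₁ × Walk Γ p y n₂ × n₁ + n₂ ≡ n
  splitAt-∈ nil (here refl) = 0 , 0 , nil , nil , refl
  splitAt-∈ (cons e w) (here refl) = 0 , _ , nil , cons e w , refl
  splitAt-∈ (cons e w) (there p∈) with splitAt-∈ w p∈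
  ... | n₁ , n₂ , w₁ , w₂ , eq = suc n₁ , n₂ , cons e w₁ , w₂ , cong suc eq

  splitAtʷ : ∀ m → Walk Γ x y (m + n) → ∃ λ z → Walk Γ x z m × Walk Γ z y n
  splitAtʷ {x = x} zero w = x , nil , w
  splitAtʷ (suc m) (cons e w) with splitAtʷ m w
  ... | z , w₁ , w₂ = z , cons e w₁ , w₂

  _∷ʳʷ_ : Walk Γ x y n → E Γ y z → Walk Γ x z (suc n)
  nil ∷ʳʷ e = cons e nil
  cons e′ w ∷ʳʷ e = cons e′ (w ∷ʳʷ e)

  reverseʷ : Walk Γ x y n → Walk Γ y x n
  reverseʷ nil = nil
  reverseʷ (cons e w) = reverseʷ w ∷ʳʷ sym Γ e

  vertices-linked : (w : Walk Γ x y n) → Linked (E Γ) (vertices w)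
  vertices-linked nil = [-]
  vertices-linked (cons e nil) = e ∷ [-]
  vertices-linked (cons e (cons e′ w)) = e ∷ vertices-linked (cons e′ w)

  shortest⇒Unique : (w : Walk Γ x y n) → (∀ {m} → Walk Γ x y m → n ≤ m) → Unique (vertices w)
  shortest⇒Unique nil _ = [] ∷ []
  shortest⇒Unique {x = x} (cons e w) shortest =
    All.tabulate revisit ∷ shortest⇒Unique w (≤-pred ∘ shortest ∘ cons e)
    where
    -- a walk revisiting its start can be shortcut
    revisit : p ∈ vertices w → x ≢ p
    revisit p∈ refl with splitAt-∈ w p∈
    ... | n₁ , n₂ , _ , w₂ , eq = <⇒≱ (s≤s (subst (n₂ ≤_) eq (m≤n+m n₂ n₁))) (shortest w₂)

  DistLe-mono : m ≤ n → DistLe Γ x y m → DistLe Γ x y n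
  DistLe-mono m≤n (k , k≤m , w) = k , ≤-trans k≤m m≤n , w

  DistLe-sym : DistLe Γ x y n → DistLe Γ y x n
  DistLe-sym (k , k≤n , w) = k , k≤n , reverseʷ w

  DistLe-trans : DistLe Γ x y m → DistLe Γ y z n → DistLe Γ x z (m + n)
  DistLe-trans (k , k≤m , w) (l , l≤n , w′) = k + l , +-mono-≤ k≤m l≤n , w ++ʷ w′

  ∈-vertices⇒DistLe : (w : Walk Γ x y n) → p ∈ vertices w → DistLe Γ p y n
  ∈-vertices⇒DistLe w p∈ with splitAt-∈ w p∈
  ... | n₁ , n₂ , _ , w₂ , eq = n₂ , subst (n₂ ≤_) eq (m≤n+m n₂ n₁) , w₂

  WalkIn-start : {P : X → Set} → WalkIn Γ P x y → P x
  WalkIn-start (nil px) = px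
  WalkIn-start (cons px _ _) = px

  WalkIn-map : {P Q : X → Set} → P ⊆ Q → WalkIn Γ P x y → WalkIn Γ Q x y
  WalkIn-map P⊆Q (nil px) = nil (P⊆Q px)
  WalkIn-map P⊆Q (cons px e w) = cons (P⊆Q px) e (WalkIn-map P⊆Q w)

  WalkIn-join : {P : X → Set} → WalkIn Γ P x y → E Γ y z → WalkIn Γ P z p → WalkIn Γ P x p
  WalkIn-join (nil px) e w = cons px e w
  WalkIn-join (cons px e′ w′) e w = cons px e′ (WalkIn-join w′ e w)

  walk⇒WalkIn : {P : X → Set} (w : Walk Γ x y n) → All P (vertices w) → WalkIn Γ P x y
  walk⇒WalkIn nil (px ∷ []) = nil px
  walk⇒WalkIn (cons e w) (px ∷ ps) = cons px e (walk⇒WalkIn w ps)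

open Walks public

Unique-++⁻ˡ : ∀ {A : Set} (xs : List A) {ys : List A} → Unique (xs ++ ys) → Unique xs
Unique-++⁻ˡ [] _ = []
Unique-++⁻ˡ (x ∷ xs) (x∉ ∷ u) = ++⁻ˡ xs x∉ ∷ Unique-++⁻ˡ xs u

Linked-close : ∀ {A : Set} {R : A → A → Set} (xs : List A) {y z : A} {ys : List A} →
  Linked R (xs ++ y ∷ ys) → R y z → Linked R ((xs ++ y ∷ []) ++ z ∷ [])
Linked-close [] _ r = r ∷ [-]
Linked-close (_ ∷ []) (r ∷ l) r′ = r ∷ Linked-close [] l r′
Linked-close (_ ∷ _ ∷ xs) (r ∷ l) r′ = r ∷ Linked-close (_ ∷ xs) l r′

module Acyclic {W : Set} (T : Graph W) (acyclic : ¬ Cycle T) where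

  no-chord : ∀ {c s y} S → Unique (c ∷ s ∷ S) → Linked (E T) (c ∷ s ∷ S) → y ∈ S → ¬ E T c y
  no-chord {c} {s} {y} S u l y∈S e with ∈-∃++ y∈S
  ... | C , D , refl =
    acyclic (c , s ∷ C ++ y ∷ [] , two≤ C , prefix-unique , Linked-close (c ∷ s ∷ C) l (sym T e))
    where
    two≤ : ∀ C → 2 ≤ length (s ∷ C ++ y ∷ [])
    two≤ [] = s≤s (s≤s z≤n)
    two≤ (_ ∷ _) = s≤s (s≤s z≤n)
    prefix-unique : Unique (c ∷ s ∷ C ++ y ∷ [])
    prefix-unique = Unique-++⁻ˡ (c ∷ s ∷ C ++ y ∷ [])
      (subst Unique (cong (λ t → c ∷ s ∷ t) (≡.sym (++-assoc C (y ∷ []) D))) u)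

  -- Induction on the walk: a step to a vertex off the path extends the path backwards, a step to
  -- its second vertex shortens it, and any other step would be a chord.
  path-vertex-separates : ∀ {v b} c (A B : List W) →
    Unique (c ∷ A ++ v ∷ B) → Linked (E T) (c ∷ A ++ v ∷ B) → b ∈ v ∷ B →
    ¬ WalkIn T (v ≢_) c b
  path-vertex-separates c A B (c∉ ∷ _) _ b∈ (nil _) = All.lookup c∉ (∈-++⁺ʳ A b∈) refl
  path-vertex-separates {v} {b} c A B u l b∈ (cons {y = y} _ e w) =
    ¬¬-excluded-middle {A = y ∈ c ∷ A ++ v ∷ B} λ
      { (yes (here refl)) → irrefl T e
      ; (yes (there y∈)) → onto-path A u l y∈ w
      ; (no y∉) → path-vertex-separates y (c ∷ A) B (¬Any⇒All¬ _ y∉ ∷ u) (sym T e ∷ l) b∈ w }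
    where
    onto-path : ∀ A → Unique (c ∷ A ++ v ∷ B) → Linked (E T) (c ∷ A ++ v ∷ B) →
      y ∈ A ++ v ∷ B → ¬ WalkIn T (v ≢_) y b
    onto-path [] _ _ (here refl) w = WalkIn-start w refl
    onto-path [] u l (there y∈B) _ = no-chord B u l y∈B e
    onto-path (a ∷ A′) (_ ∷ u) (_ ∷ l) (here refl) w = path-vertex-separates a A′ B u l b∈ w
    onto-path (a ∷ A′) u l (there y∈) _ = no-chord (A′ ++ v ∷ B) u l y∈ e

  cut-vertex-on-every-walk : ∀ {a v b n₁ n₂ m} (g₁ : Walk T a v n₁) (g₂ : Walk T v b n₂) →
    Unique (vertices (g₁ ++ʷ g₂)) → (w : Walk T a b m) → ¬ ¬ (v ∈ vertices w)
  cut-vertex-on-every-walk nil _ _ _ v∉ = v∉ (here refl)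
  cut-vertex-on-every-walk {a} {v} {b} (cons e g₁) g₂ u w v∉
    with vertices-++ʷ g₁ g₂
  ... | A , eq = path-vertex-separates a A (laterVertices g₂)
      (subst Unique (cong (a ∷_) eq) u)
      (subst (Linked (E T)) (cong (a ∷_) eq) (vertices-linked (cons e g₁ ++ʷ g₂)))
      (end∈vertices g₂) (walk⇒WalkIn w (¬Any⇒All¬ _ v∉))

module Lipschitz {V W : Set} (G : Graph V) (T : Graph W) (φ : V → W) {K : ℕ}
  (lipschitz : ∀ {x y} → E G x y → DistLe T (φ x) (φ y) K) where

  walkIn-image : ∀ {P : V → Set} {u v} → WalkIn G P u v →
    ∃₂ λ n (w : Walk T (φ u) (φ v) n) → ∀ {q} → q ∈ vertices w → ∃ λ x → P x × DistLe T q (φ x) K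
  walkIn-image {u = u} (nil pu) = 0 , nil , λ { (here refl) → u , pu , 0 , z≤n , nil }
  walkIn-image {P} (cons _ e rest) with lipschitz e | walkIn-image rest
  ... | n₁ , n₁≤K , step | n₂ , w , close =
    n₁ + n₂ , step ++ʷ w , [ near-next , close ]′ ∘ ∈-++ʷ⁻ step w
    where
    near-next : ∀ {q} → q ∈ vertices step → ∃ λ x → P x × DistLe T q (φ x) K
    near-next q∈ = _ , WalkIn-start rest , DistLe-mono n₁≤K (∈-vertices⇒DistLe step q∈)

¬¬-least : ∀ {P : ℕ → Set} {n} → P n → ¬ ¬ (∃ λ m → P m × ∀ {k} → P k → m ≤ k)
¬¬-least {P} {n} = <-rec (λ n → P n → ¬ ¬ Least) least-below n
  where
  Least : Set
  Least = ∃ λ m → P m × ∀ {k} → P k → m ≤ k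
  least-below : ∀ n → (∀ {m} → m < n → P m → ¬ ¬ Least) → P n → ¬ ¬ Least
  least-below n below pn ¬least = ¬least (n , pn , λ pk → ≮⇒≥ λ k<n → below k<n pk ¬least)

injection-into-list : ∀ {A : Set} {n} {R : List A} {f : Fin n → A} →
  Injective _≡_ _≡_ f → (∀ i → f i ∈ R) → n ≤ length R
injection-into-list {R = R} {f} f-injective f∈R = ≮⇒≥ λ |R|<n →
  let i , j , i<j , same-index = Fin.pigeonhole |R|<n (index ∘ f∈R)
  in Fin.<⇒≢ i<j (f-injective (begin
    f i                       ≡⟨ lookup-index (f∈R i) ⟩
    lookup R (index (f∈R i))  ≡⟨ cong (lookup R) same-index ⟩
    lookup R (index (f∈R j))  ≡⟨ ≡.sym (lookup-index (f∈R j)) ⟩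
    f j                       ∎))
  where open ≡.≡-Reasoning

module Balls {V : Set} (G : Graph V) (Δ : ℕ)
  (degree≤ : ∀ v (l : List V) → Unique l → All (E G v) l → length l ≤ Δ) where

  ballBound : ℕ → ℕ
  ballBound zero = 1
  ballBound (suc q) = suc (Δ * ballBound q)

  -- Membership is only known up to double negation, since adjacency need not be decidable.
  Covers : V → ℕ → List V → Set
  Covers v q R = ∀ x → DistLe G v x q → ¬ ¬ (x ∈ R)

  BallCover : V → ℕ → Set
  BallCover v q = ∃ λ R → length R ≤ ballBound q × Covers v q R

  CoversNeighbours : V → List V → Set
  CoversNeighbours v R = ∀ {u} → E G v u → ¬ ¬ (u ∈ R)

  -- Greedily add new neighbours; the degree bound stops this within Δ + 1 steps.
  neighbour-list : ∀ v → ¬ ¬ (∃ λ R → length R ≤ Δ × CoversNeighbours v R)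
  neighbour-list v = extend (suc Δ) [] [] [] (n<1+n Δ)
    where
    extend : ∀ k (l : List V) → Unique l → All (E G v) l → Δ < length l + k →
      ¬ ¬ (∃ λ R → length R ≤ Δ × CoversNeighbours v R)
    extend zero l u nb Δ< _ = <⇒≱ (subst (Δ <_) (+-identityʳ _) Δ<) (degree≤ v l u nb)
    extend (suc k) l u nb Δ< κ = ¬¬-excluded-middle {A = ∃ λ x → E G v x × x ∉ l} λ
      { (yes (x , e , x∉)) → extend k (x ∷ l) (¬Any⇒All¬ l x∉ ∷ u) (e ∷ nb) (subst (Δ <_) (+-suc _ k) Δ<) κ
      ; (no complete) → κ (l , degree≤ v l u nb , λ e x∉ → complete (_ , e , x∉)) }

  concat-covers : ∀ {q} (l : List V) → All (λ u → BallCover u q) l →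
    ∃ λ R → length R ≤ length l * ballBound q × ∀ {u} → u ∈ l → Covers u q R
  concat-covers [] [] = [] , z≤n , λ ()
  concat-covers {q} (u ∷ l) ((Rᵤ , |Rᵤ|≤ , coversᵤ) ∷ rest) with concat-covers l rest
  ... | R , |R|≤ , covers =
    Rᵤ ++ R , subst (_≤ _) (≡.sym (length-++ Rᵤ)) (+-mono-≤ |Rᵤ|≤ |R|≤) , covers-++
    where
    covers-++ : ∀ {u′} → u′ ∈ u ∷ l → Covers u′ q (Rᵤ ++ R)
    covers-++ (here refl) x d = ¬¬-map ∈-++⁺ˡ (coversᵤ x d)
    covers-++ (there u′∈) x d = ¬¬-map (∈-++⁺ʳ Rᵤ) (covers u′∈ x d)

  ball-cover : ∀ q v → ¬ ¬ BallCover v q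
  ball-cover zero v = pure (v ∷ [] , ≤-refl , λ { _ (_ , z≤n , nil) → pure (here refl) })
  ball-cover (suc q) v = do
    Nᵥ , |Nᵥ|≤Δ , neighbours ← neighbour-list v
    covers ← All.sequenceM 0ℓ ¬¬-Monad (All.tabulate λ {u} _ → ball-cover q u)
    let R , |R|≤ , covered = concat-covers Nᵥ covers
    pure (v ∷ R , s≤s (≤-trans |R|≤ (*-monoˡ-≤ (ballBound q) |Nᵥ|≤Δ)) , λ
      { _ (_ , _ , nil) → pure (here refl)
      ; x (suc n , s≤s n≤q , cons e w) → do
          u∈ ← neighbours e
          ¬¬-map there (covered u∈ x (n , n≤q , w)) })

  injective-ball⇒≤ : ∀ {n q v} (f : Fin n → V) → Injective _≡_ _≡_ f →
    (∀ i → DistLe G v (f i) q) → ¬ ¬ (n ≤ ballBound q)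
  injective-ball⇒≤ f f-injective close = do
    R , |R|≤ , covers ← ball-cover _ _
    f∈R ← Fin.sequence rawApplicative (λ i → covers (f i) (close i))
    pure (≤-trans (injection-into-list f-injective f∈R) |R|≤)

module CliqueExclusion {V W : Set} (G : Graph V) (T : Graph W)
  (Δ : ℕ) (degree≤ : ∀ v (l : List V) → Unique l → All (E G v) l → length l ≤ Δ)
  (connected : Connected T) (acyclic : ¬ Cycle T) (φ : V → W) (γ c : ℕ)
  (upper : ∀ x y m → DistLe G x y m → DistLe T (φ x) (φ y) (γ * (m + c)))
  (lower : ∀ x y n → DistLe T (φ x) (φ y) n → DistLe G x y (γ * n + c)) where

  open Balls G Δ degree≤
  open Acyclic T acyclic

  -- K bounds the tree distance between images of adjacent vertices, and Q the G-distance
  -- between two vertices whose images are within M of a common point.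
  K M Q N : ℕ
  K = γ * (1 + c)
  M = suc K
  Q = γ * (M + M) + c
  N = suc (ballBound Q)

  clique : Graph (Fin N)
  clique = record { E = _≢_ ; sym = λ i≢j → i≢j ∘ ≡.sym ; irrefl = λ i≢i → i≢i refl }

  adjacent-images : ∀ {x y} → E G x y → DistLe T (φ x) (φ y) K
  adjacent-images e = upper _ _ 1 (1 , ≤-refl , cons e nil)

  open Lipschitz G T φ adjacent-images

  module Branches (B : Fin N → V → Set) (nonempty : ∀ i → ∃ (B i))
    (disjoint : ∀ i j v → B i v → B j v → i ≡ j)
    (branch-connected : ∀ i u v → B i u → B i v → WalkIn G (B i) u v)
    (adjacent : ∀ i j → i ≢ j → ∃₂ λ u v → B i u × B j v × E G u v) where

    Near : W → Fin N → Set
    Near p j = ∃ λ b → B j b × DistLe T p (φ b) M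

    Hub : W → Set
    Hub p = ∀ j → Near p j

    ¬Hub : ∀ {p} → ¬ Hub p
    ¬Hub hub = injective-ball⇒≤ b b-injective b-close 1+n≰n
      where
      b : Fin N → V
      b j = proj₁ (hub j)
      b-injective : Injective _≡_ _≡_ b
      b-injective {i} {j} bᵢ≡bⱼ =
        disjoint i j (b i) (proj₁ (proj₂ (hub i))) (subst (B j) (≡.sym bᵢ≡bⱼ) (proj₁ (proj₂ (hub j))))
      b-close : ∀ j → DistLe G (b zero) (b j) Q
      b-close j = lower _ _ (M + M) (DistLe-trans (DistLe-sym (proj₂ (proj₂ (hub zero)))) (proj₂ (proj₂ (hub j))))

    -- Any vertex of T would do; one is at hand through a branch set.
    root : W
    root = φ (proj₁ (nonempty zero))

    record Nearest (i : Fin N) : Set where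
      field
        dist     : ℕ
        point    : V
        point∈B  : B i point
        geodesic : Walk T root (φ point) dist
        minimal  : ∀ {k x} → B i x → Walk T root (φ x) k → dist ≤ k

    open Nearest

    ¬¬-nearest : ∀ i → ¬ ¬ Nearest i
    ¬¬-nearest i = do
      let x , x∈B = nonempty i
      let _ , w = connected root (φ x)
      d , (y , y∈B , g) , least ← ¬¬-least {P = λ k → ∃ λ x → B i x × Walk T root (φ x) k} (x , x∈B , w)
      pure (record { dist = d ; point = y ; point∈B = y∈B ; geodesic = g
                   ; minimal = λ x∈B w → least (_ , x∈B , w) })

    module Farthest (nearest : ∀ i → Nearest i) (i* : Fin N)
      (farthest : ∀ j → dist (nearest j) ≤ dist (nearest i*)) where

      D* : ℕ
      D* = dist (nearest i*)

      x* : V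
      x* = point (nearest i*)

      module Cut (o : ℕ) {p : W} (g₁ : Walk T root p o) (g₂ : Walk T p (φ x*) M)
        (o+M≡D* : o + M ≡ D*) where

        D*-minimal : ∀ {k x} → B i* x → Walk T root (φ x) k → o + M ≤ k
        D*-minimal x∈B w = subst (_≤ _) (≡.sym o+M≡D*) (minimal (nearest i*) x∈B w)

        far-from-i* : ∀ {u} → B i* u → ¬ DistLe T p (φ u) K
        far-from-i* u∈B (k , k≤K , w) = <⇒≱ (+-cancelˡ-≤ o M k (D*-minimal u∈B (g₁ ++ʷ w))) k≤K

        p-on-every-walk : ∀ {m} (w : Walk T root (φ x*) m) → ¬ ¬ (p ∈ vertices w)
        p-on-every-walk = cut-vertex-on-every-walk g₁ g₂
          (shortest⇒Unique (g₁ ++ʷ g₂) (D*-minimal (point∈B (nearest i*))))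

        near-via-geodesic : ∀ j → p ∈ vertices (geodesic (nearest j)) → Near p j
        near-via-geodesic j p∈ with splitAt-∈ (geodesic (nearest j)) p∈
        ... | n₁ , n₂ , w₁ , w₂ , n₁+n₂≡ = point (nearest j) , point∈B (nearest j) , n₂ , n₂≤M , w₂
          where
          open ≤-Reasoning
          o≤n₁ : o ≤ n₁
          o≤n₁ = +-cancelʳ-≤ M o n₁ (D*-minimal (point∈B (nearest i*)) (w₁ ++ʷ g₂))
          n₂≤M : n₂ ≤ M
          n₂≤M = +-cancelˡ-≤ o n₂ M (begin
            o + n₂              ≤⟨ +-monoˡ-≤ n₂ o≤n₁ ⟩
            n₁ + n₂             ≡⟨ n₁+n₂≡ ⟩
            dist (nearest j)    ≤⟨ farthest j ⟩
            D*                  ≡⟨ ≡.sym o+M≡D* ⟩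
            o + M               ∎)

        near-via-bridge : ∀ j → WalkIn G (B j ∪ B i*) (point (nearest j)) x* → ¬ ¬ Near p j
        near-via-bridge j path with walkIn-image path
        ... | _ , bridge , close = ¬¬-map locate (p-on-every-walk (geodesic (nearest j) ++ʷ bridge))
          where
          locate : p ∈ vertices (geodesic (nearest j) ++ʷ bridge) → Near p j
          locate p∈ with ∈-++ʷ⁻ (geodesic (nearest j)) bridge p∈
          ... | inj₁ p∈geodesic = near-via-geodesic j p∈geodesic
          ... | inj₂ p∈bridge with close p∈bridge
          ...   | x , inj₁ x∈Bⱼ , d = x , x∈Bⱼ , DistLe-mono (n≤1+n K) d
          ...   | x , inj₂ x∈B* , d = ⊥-elim (far-from-i* x∈B* d)

        hub : ¬ ¬ Hub p
        hub = Fin.sequence rawApplicative near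
          where
          near : ∀ j → ¬ ¬ Near p j
          near j with j Fin.≟ i*
          ... | yes refl = pure (x* , point∈B (nearest i*) , M , ≤-refl , g₂)
          ... | no j≢i* with adjacent i* j (j≢i* ∘ ≡.sym)
          ...   | y , z , y∈B* , z∈Bⱼ , e = near-via-bridge j (WalkIn-join
                    (WalkIn-map inj₁ (branch-connected j _ z (point∈B (nearest j)) z∈Bⱼ)) (sym G e)
                    (WalkIn-map inj₂ (branch-connected i* y x* y∈B* (point∈B (nearest i*)))))

      hub-beyond : ∀ o → o + M ≡ D* → ¬ ¬ ∃ Hub
      hub-beyond o o+M≡D* with splitAtʷ o (subst (Walk T root (φ x*)) (≡.sym o+M≡D*) (geodesic (nearest i*)))
      ... | p , g₁ , g₂ = ¬¬-map (p ,_) (Cut.hub o g₁ g₂ o+M≡D*)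

      hub-at-root : D* ≤ M → Hub root
      hub-at-root D*≤M j = point (nearest j) , point∈B (nearest j) ,
        dist (nearest j) , ≤-trans (farthest j) D*≤M , geodesic (nearest j)

      ¬¬-hub : ¬ ¬ ∃ Hub
      ¬¬-hub with M ≤? D*
      ... | yes M≤D* = let o , M+o≡D* = m≤n⇒∃[o]m+o≡n M≤D* in hub-beyond o (trans (+-comm o M) M+o≡D*)
      ... | no M≰D* = pure (root , hub-at-root (<⇒≤ (≰⇒> M≰D*)))

    ¬¬-hub : ¬ ¬ ∃ Hub
    ¬¬-hub = do
      nearest ← Fin.sequence rawApplicative ¬¬-nearest
      let i* = argmax (dist ∘ nearest) zero (allFin N)
          farthest j = All.lookup (f[xs]≤f[argmax] {f = dist ∘ nearest} zero (allFin N)) (∈-allFin j)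
      Farthest.¬¬-hub nearest i* farthest

    absurd : ⊥
    absurd = ¬¬-hub λ (_ , hub) → ¬Hub hub

  clique-not-minor : ¬ IsMinor clique G
  clique-not-minor (B , nonempty , disjoint , branch-connected , adjacent) =
    Branches.absurd B nonempty disjoint branch-connected adjacent

proposition2p3 : {V W : Set} (G : Graph V) (T : Graph W) →
    BoundedDegree G → IsTree T → BoundedDegree T → QuasiIsometric G T →
    MinorExcluded G
proposition2p3 G T (Δ , degree≤) (connected , acyclic) _ (φ , γ , c , _ , upper , lower) =
  N , clique , clique-not-minor
  where open CliqueExclusion G T Δ degree≤ connected acyclic φ γ c upper lower
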